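{- For all $\delta,B>0$ there are $C,d_0\ge1$ such that the following holds. Let $M$ be a positive integer and let $A_1,\ldots,A_K\subset[-M,M]\cap\mathbb Z$ with $K\ge CM$ and $|A_i|\ge\delta M\ge 2$ for all $i\in[K]$. Then there exist $a\in\mathbb Z$ and $d\in\mathbb N$ with $1\le d\le d_0$ such that $$\{a+id : 0\le i\le BM^2\}\subset A_1+A_2+\cdots+A_K,$$ where $A_1+\cdots+A_K=\{a_1+\cdots+a_K : a_i\in A_i \text{ for all } i\}$. -}

module Defs where

open import Data.Nat using (ℕ; zero; suc)
open import Data.Integer using (ℤ; +_; -_; _+_; _≤_)
open import Data.Fin using (Fin)
open import Data.Product using (Σ; _×_)
open import Data.List using (List)
open import Data.List.Membership.Propositional using (_∈_)
open import Data.Rational using (ℚ; _/_)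
open import Relation.Binary.PropositionalEquality using (_≡_)

ℕ→ℚ : ℕ → ℚ
ℕ→ℚ n = (+ n) / 1

sumFin : (K : ℕ) → (Fin K → ℤ) → ℤ
sumFin zero    f = + 0
sumFin (suc K) f = f Fin.zero + sumFin K (λ i → f (Fin.suc i))

InRange : ℕ → ℤ → Set
InRange M x = (- (+ M) ≤ x) × (x ≤ + M)

_∈Sumset_ : ℤ → {K : ℕ} → (Fin K → List ℤ) → Set
_∈Sumset_ x {K} A =
  Σ (Fin K → ℤ) λ f → ((i : Fin K) → f i ∈ A i) × (sumFin K f ≡ x)

{-# OPTIONS --safe #-}
module Submission where

-- Write δ ≥ 1/P and B ≤ b, shift every A i into [0, 2M] and use pigeonhole twice.  Blocks of length
-- 4P + 1 give two elements of A i at distance at most 4P; among the first 4P·X·M indices some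
-- distance d occurs X·M times, giving "unit jumps" u, u + d ∈ A i.  Every other index gets a
-- "long jump" u, u + ℓ d ∈ A i with ℓ ≳ M / 4P², from the largest residue class mod d.  All ℓ are
-- at most 2M ≤ 1 + #units, so the sums of subfamilies of the ℓ fill the whole interval [0, Σ ℓ]
-- (Brown's criterion, with the unit jumps as slack), and Σ ℓ ≥ bM² because of the unit jumps when
-- M is small and because of the ≳ bM long jumps when M is large.

open import Defs
open import Data.Nat
open import Data.Nat.Properties
open import Algebra.Properties.Semiring.Sum +-*-semiring
  using (sum; sum-syntax; ∑-comm; sum-cong-≗; *-distribˡ-sum; sum-replicate-zero)
open import Algebra.Properties.CommutativeSemigroup +-commutativeSemigroup using (x∙yz≈y∙xz)
open import Data.Bool using (Bool; true; false; T; not; _∧_; if_then_else_)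
open import Data.Empty using (⊥-elim)
open import Data.Fin as Fin using (Fin; zero; suc; toℕ; fromℕ<)
open import Data.Fin.Properties using (toℕ<n; toℕ-fromℕ<; pigeonhole)
open import Data.Integer as ℤ using (ℤ; +_; +[1+_]; ∣_∣)
import Data.Integer.Properties as ℤ
import Data.Integer.Tactic.RingSolver as ℤ-Solver
open import Algebra.Properties.AbelianGroup ℤ.+-0-abelianGroup using (∙-cancelʳ)
open import Data.List using (List; []; _∷_; length; lookup; filter; map)
open import Data.List.Extrema.Nat using (min; max; argmin-sel; argmax-sel; min≤⊤; min≤xs; ⊥≤max; xs≤max)
open import Data.List.Membership.Propositional using (_∈_)
open import Data.List.Membership.Propositional.Properties using (∈-lookup; ∈-filter⁻; ∈-map⁻)
open import Data.List.Properties using (length-map)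
open import Data.List.Relation.Unary.All as All using (All; []; _∷_)
import Data.List.Relation.Unary.All.Properties as All
open import Data.List.Relation.Unary.Any using (here; there)
open import Data.List.Relation.Unary.Unique.Propositional using (Unique; []; _∷_)
import Data.List.Relation.Unary.Unique.Propositional.Properties as Unique
open import Data.Nat.DivMod using (_/_; _%_; m≡m%n+[m/n]*n; m%n≡m∸m/n*n; m%n<n; m/n*n≤m; /-monoˡ-≤)
open import Data.Nat.Tactic.RingSolver using (solve-∀)
open import Data.Product using (Σ; ∃-syntax; ∃₂; _×_; _,_; proj₁; proj₂)
open import Data.Rational using (ℚ; mkℚ; Positive; toℚᵘ; ↥_; ↧ₙ_) renaming (_≤_ to _≤ℚ_; _*_ to _*ℚ_)
open import Data.Rational.Properties using (toℚᵘ-fromℚᵘ; toℚᵘ-homo-*; toℚᵘ-mono-≤) renaming (≤-trans to ≤ℚ-trans)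
open import Data.Rational.Unnormalised using (mkℚᵘ; *≤*) renaming (_≃_ to _≃ᵘ_; _*_ to _*ᵘ_)
import Data.Rational.Unnormalised.Properties as ℚᵘ
open import Data.Sum using ([_,_]′)
open import Data.Unit using (tt)
import Data.Vec.Functional as Vector
open import Function using (_∘_; id)
open import Relation.Binary.Definitions using (tri<; tri≈; tri>)
open import Relation.Binary.PropositionalEquality
open import Relation.Nullary using (yes; no; does)
open import Relation.Unary using (Decidable)

𝟙 : Bool → ℕ
𝟙 true  = 1
𝟙 false = 0

count : ∀ {K} → (Fin K → Bool) → ℕ
count {K} p = ∑[ i < K ] 𝟙 (p i)

∑-mono-≤ : ∀ {K} {f g : Fin K → ℕ} → (∀ i → f i ≤ g i) → sum f ≤ sum g
∑-mono-≤ {zero}  f≤g = z≤n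
∑-mono-≤ {suc K} f≤g = +-mono-≤ (f≤g zero) (∑-mono-≤ (f≤g ∘ suc))

count-true : ∀ K → count {K} (λ _ → true) ≡ K
count-true zero    = refl
count-true (suc K) = cong suc (count-true K)

count-<ᵇ : ∀ {K h} → h ≤ K → count {K} (λ i → toℕ i <ᵇ h) ≡ h
count-<ᵇ {K} {zero}      _         = sum-replicate-zero K
count-<ᵇ {suc K} {suc h} (s≤s h≤K) = cong suc (count-<ᵇ h≤K)

count+count-not : ∀ {K} (p : Fin K → Bool) → count p + count (not ∘ p) ≡ K
count+count-not {zero}  p = refl
count+count-not {suc K} p with p zero
... | true  = cong suc (count+count-not (p ∘ suc))
... | false = trans (+-suc _ _) (cong suc (count+count-not (p ∘ suc)))

count-mono : ∀ {K} {p q : Fin K → Bool} → (∀ i → T (p i) → T (q i)) → count p ≤ count q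
count-mono {p = p} {q} p⇒q = ∑-mono-≤ (λ i → 𝟙-mono (p i) (q i) (p⇒q i))
  where
  𝟙-mono : ∀ a b → (T a → T b) → 𝟙 a ≤ 𝟙 b
  𝟙-mono false _     _   = z≤n
  𝟙-mono true  true  _   = ≤-refl
  𝟙-mono true  false a⇒b = ⊥-elim (a⇒b _)

*-count≤*-sum : ∀ {K} {p : Fin K → Bool} {ℓ : Fin K → ℕ} m a →
                (∀ i → T (p i) → m ≤ a * ℓ i) → m * count p ≤ a * sum ℓ
*-count≤*-sum {K} {p} {ℓ} m a bound = begin
  m * count p                 ≡⟨ *-distribˡ-sum m (𝟙 ∘ p) ⟩
  (∑[ j < K ] (m * 𝟙 (p j)))  ≤⟨ ∑-mono-≤ termwise ⟩
  (∑[ j < K ] (a * ℓ j))      ≡⟨ *-distribˡ-sum a ℓ ⟨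
  a * sum ℓ                   ∎
  where
  open ≤-Reasoning
  termwise : ∀ i → m * 𝟙 (p i) ≤ a * ℓ i
  termwise i with p i | bound i
  ... | true  | m≤aℓ = ≤-trans (≤-reflexive (*-identityʳ m)) (m≤aℓ _)
  ... | false | _    = ≤-trans (≤-reflexive (*-zeroʳ m)) z≤n

ones : ∀ {K} → (Fin K → ℕ) → ℕ
ones ℓ = count (λ i → ℓ i ≡ᵇ 1)

ones≤sum : ∀ {K} (ℓ : Fin K → ℕ) → ones ℓ ≤ sum ℓ
ones≤sum ℓ = ∑-mono-≤ (λ i → 𝟙[n≡1]≤n (ℓ i))
  where
  𝟙[n≡1]≤n : ∀ n → 𝟙 (n ≡ᵇ 1) ≤ n
  𝟙[n≡1]≤n zero          = z≤n
  𝟙[n≡1]≤n (suc zero)    = ≤-refl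
  𝟙[n≡1]≤n (suc (suc n)) = z≤n

averaging : ∀ {c} (g : Fin (suc c) → ℕ) → ∃[ v ] sum g ≤ suc c * g v
averaging {zero}  g = zero , ≤-refl
averaging {suc c} g with averaging (g ∘ suc)
... | v , ∑≤ with g zero ≤? g (suc v)
...   | yes g₀≤ = suc v , +-mono-≤ g₀≤ ∑≤
...   | no  g₀≰ = zero , +-monoʳ-≤ (g zero) (≤-trans ∑≤ (*-monoʳ-≤ (suc c) (<⇒≤ (≰⇒> g₀≰))))

∑-𝟙-≡ᵇ : ∀ {c} a → a < c → ∑[ v < c ] 𝟙 (a ≡ᵇ toℕ v) ≡ 1
∑-𝟙-≡ᵇ {suc c} zero    _         = cong suc (sum-replicate-zero c)
∑-𝟙-≡ᵇ {suc c} (suc a) (s≤s a<c) = ∑-𝟙-≡ᵇ a a<c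

∑-count-classes : ∀ {K c} (p : Fin K → Bool) (f : Fin K → ℕ) → (∀ i → f i < c) →
                  ∑[ v < c ] count (λ i → p i ∧ (f i ≡ᵇ toℕ v)) ≡ count p
∑-count-classes {K} {c} p f f<c = begin
  (∑[ v < c ] ∑[ i < K ] 𝟙 (p i ∧ (f i ≡ᵇ toℕ v)))  ≡⟨ ∑-comm {c} {K} (λ v i → 𝟙 (p i ∧ (f i ≡ᵇ toℕ v))) ⟩
  (∑[ i < K ] ∑[ v < c ] 𝟙 (p i ∧ (f i ≡ᵇ toℕ v)))  ≡⟨ sum-cong-≗ classes-of ⟩
  count p                                           ∎
  where
  open ≡-Reasoning
  classes-of : ∀ i → ∑[ v < c ] 𝟙 (p i ∧ (f i ≡ᵇ toℕ v)) ≡ 𝟙 (p i)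
  classes-of i with p i
  ... | true  = ∑-𝟙-≡ᵇ (f i) (f<c i)
  ... | false = sum-replicate-zero c

pigeonhole-count : ∀ {K} c .{{_ : NonZero c}} (p : Fin K → Bool) (f : Fin K → ℕ) → (∀ i → f i < c) →
                   ∃[ v ] v < c × count p ≤ c * count (λ i → p i ∧ (f i ≡ᵇ v))
pigeonhole-count (suc c) p f f<c with averaging (λ v → count (λ i → p i ∧ (f i ≡ᵇ toℕ v)))
... | v , ∑≤ = toℕ v , toℕ<n v ,
               subst (_≤ suc c * count (λ i → p i ∧ (f i ≡ᵇ toℕ v))) (∑-count-classes p f f<c) ∑≤

-- Subset sums

select : ∀ {K} → (Fin K → Bool) → (Fin K → ℕ) → Fin K → ℕ
select s ℓ i = if s i then ℓ i else 0

SubsetSum : ∀ {K} → (Fin K → ℕ) → ℕ → Set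
SubsetSum ℓ n = ∃[ s ] sum (select s ℓ) ≡ n

SubsetSumWithin : ∀ {K} → ℕ → (Fin K → ℕ) → ℕ → Set
SubsetSumWithin t ℓ n = ∃[ m ] SubsetSum ℓ m × m ≤ n × n ≤ t + m

skip-first : ∀ {K} x {ℓ : Fin K → ℕ} {m} → SubsetSum ℓ m → SubsetSum (x Vector.∷ ℓ) m
skip-first x (s , Σ≡m) = false Vector.∷ s , Σ≡m

take-first : ∀ {K} x {ℓ : Fin K → ℕ} {m} → SubsetSum ℓ m → SubsetSum (x Vector.∷ ℓ) (x + m)
take-first x (s , Σ≡m) = true Vector.∷ s , cong (_+_ x) Σ≡m

-- A first term 1 is deferred into the slack t; a larger one is used exactly when the others cannot reach n.
subsetSums-within : ∀ {K} (ℓ : Fin K → ℕ) t → (∀ i → ℓ i ≤ suc (t + ones ℓ)) →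
                    ∀ {n} → n ≤ t + sum ℓ → SubsetSumWithin t ℓ n
subsetSums-within-∷ : ∀ {K} x (ℓ : Fin K → ℕ) t →
                      x ≤ suc (t + ones (x Vector.∷ ℓ)) → (∀ i → ℓ i ≤ suc (t + ones (x Vector.∷ ℓ))) →
                      ∀ {n} → n ≤ t + (x + sum ℓ) → SubsetSumWithin t (x Vector.∷ ℓ) n

subsetSums-within {zero}  ℓ t _  n≤t = 0 , ((λ ()) , refl) , z≤n , n≤t
subsetSums-within {suc K} ℓ t bd     = subsetSums-within-∷ (ℓ zero) (ℓ ∘ suc) t (bd zero) (bd ∘ suc)

subsetSums-within-∷ zero ℓ t _ bd n≤
  with m , Σ , m≤n , n≤t+m ← subsetSums-within ℓ t bd n≤
  = m , skip-first 0 Σ , m≤n , n≤t+m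
subsetSums-within-∷ (suc zero) ℓ t _ bd {n} n≤ =
  extend (subsetSums-within ℓ (suc t) bd′ (≤-trans n≤ (≤-reflexive (+-suc t (sum ℓ)))))
  where
  bd′ : ∀ i → ℓ i ≤ suc (suc t + ones ℓ)
  bd′ i = ≤-trans (bd i) (≤-reflexive (cong suc (+-suc t (ones ℓ))))
  extend : SubsetSumWithin (suc t) ℓ n → SubsetSumWithin t (1 Vector.∷ ℓ) n
  extend (m , Σ , m≤n , n≤1+t+m) with n ≤? t + m
  ... | yes n≤t+m = m , skip-first 1 Σ , m≤n , n≤t+m
  ... | no  n≰t+m = suc m , take-first 1 Σ , ≤-trans (s≤s (m≤n+m m t)) (≰⇒> n≰t+m)
                  , ≤-trans n≤1+t+m (≤-reflexive (sym (+-suc t m)))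
subsetSums-within-∷ x@(suc (suc _)) ℓ t x≤ bd {n} n≤ with n ≤? t + sum ℓ
... | yes n≤′ with m , Σ , m≤n , n≤t+m ← subsetSums-within ℓ t bd n≤′
  = m , skip-first x Σ , m≤n , n≤t+m
... | no  n≰ = extend (subsetSums-within ℓ t bd n∸x≤)
  where
  x≤n : x ≤ n
  x≤n = ≤-trans x≤ (≤-trans (s≤s (+-monoʳ-≤ t (ones≤sum ℓ))) (≰⇒> n≰))
  n∸x≤ : n ∸ x ≤ t + sum ℓ
  n∸x≤ = m≤n+o⇒m∸n≤o n x (≤-trans n≤ (≤-reflexive (x∙yz≈y∙xz t x (sum ℓ))))
  extend : SubsetSumWithin t ℓ (n ∸ x) → SubsetSumWithin t (x Vector.∷ ℓ) n
  extend (m , Σ , m≤n∸x , n∸x≤t+m) = x + m , take-first x Σ , x+m≤n , n≤t+[x+m]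
    where
    open ≤-Reasoning
    x+m≤n : x + m ≤ n
    x+m≤n = ≤-trans (+-monoʳ-≤ x m≤n∸x) (≤-reflexive (m+[n∸m]≡n x≤n))
    n≤t+[x+m] : n ≤ t + (x + m)
    n≤t+[x+m] = begin
      n            ≡⟨ m+[n∸m]≡n x≤n ⟨
      x + (n ∸ x)  ≤⟨ +-monoʳ-≤ x n∸x≤t+m ⟩
      x + (t + m)  ≡⟨ x∙yz≈y∙xz x t m ⟩
      t + (x + m)  ∎

subsetSums-cover : ∀ {K} (ℓ : Fin K → ℕ) → (∀ i → ℓ i ≤ suc (ones ℓ)) →
                   ∀ {n} → n ≤ sum ℓ → SubsetSum ℓ n
subsetSums-cover ℓ bd n≤ with m , Σ , m≤n , n≤m ← subsetSums-within ℓ 0 bd n≤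
  = subst (SubsetSum ℓ) (≤-antisym m≤n n≤m) Σ

lookup-distinct : ∀ {X : Set} {xs : List X} → Unique xs →
                  ∀ {i j} → i Fin.< j → lookup xs i ≢ lookup xs j
lookup-distinct {xs = x ∷ xs} (x∉xs ∷ _)   {zero}  {suc j} _         = All.lookup x∉xs (∈-lookup j)
lookup-distinct {xs = x ∷ xs} (_    ∷ xs!) {suc i} {suc j} (s≤s i<j) = lookup-distinct xs! i<j

pigeonhole-∈ : ∀ {X : Set} (f : X → ℕ) {L} {xs : List X} → Unique xs → All (λ x → f x < L) xs →
               L < length xs → ∃₂ λ x y → x ∈ xs × y ∈ xs × x ≢ y × f x ≡ f y
pigeonhole-∈ f {L} {xs} xs! f<L L<n = collision (pigeonhole L<n (λ i → fromℕ< (f<L′ i)))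
  where
  f<L′ : ∀ i → f (lookup xs i) < L
  f<L′ i = All.lookup f<L (∈-lookup i)
  collision : ∃₂ (λ i j → i Fin.< j × fromℕ< (f<L′ i) ≡ fromℕ< (f<L′ j)) →
              ∃₂ λ x y → x ∈ xs × y ∈ xs × x ≢ y × f x ≡ f y
  collision (i , j , i<j , same) =
    lookup xs i , lookup xs j , ∈-lookup i , ∈-lookup j , lookup-distinct xs! i<j ,
    trans (sym (toℕ-fromℕ< (f<L′ i))) (trans (cong toℕ same) (toℕ-fromℕ< (f<L′ j)))

injective⇒length≤ : ∀ {X : Set} (f : X → ℕ) {L} {xs : List X} → Unique xs → All (λ x → f x < L) xs →
                    (∀ {x y} → x ∈ xs → y ∈ xs → f x ≡ f y → x ≡ y) → length xs ≤ L
injective⇒length≤ f {L} {xs} xs! f<L inj with length xs ≤? L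
... | yes n≤L = n≤L
... | no  n≰L with x , y , x∈ , y∈ , x≢y , fx≡fy ← pigeonhole-∈ f xs! f<L (≰⇒> n≰L)
  = ⊥-elim (x≢y (inj x∈ y∈ fx≡fy))

length-filter≡count : ∀ {X : Set} {P : X → Set} (P? : Decidable P) (xs : List X) →
                      length (filter P? xs) ≡ count (λ i → does (P? (lookup xs i)))
length-filter≡count P? []       = refl
length-filter≡count P? (x ∷ xs) with does (P? x)
... | true  = cong suc (length-filter≡count P? xs)
... | false = length-filter≡count P? xs

pigeonhole-filter : ∀ {X : Set} c .{{_ : NonZero c}} (f : X → ℕ) {xs : List X} → All (λ x → f x < c) xs →
                    ∃[ v ] v < c × length xs ≤ c * length (filter (λ x → f x ≟ v) xs)
pigeonhole-filter c f {xs} f<c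
  with v , v<c , n≤ ← pigeonhole-count c (λ _ → true) (f ∘ lookup xs) (λ i → All.lookup f<c (∈-lookup i))
  = v , v<c , subst₂ (λ n k → n ≤ c * k) (count-true (length xs)) (sym (length-filter≡count (λ x → f x ≟ v) xs)) n≤

map⁺-injectiveOn : ∀ {X Y : Set} {P : X → Set} (f : X → Y) → (∀ {x y} → P x → P y → f x ≡ f y → x ≡ y) →
                   ∀ {xs} → All P xs → Unique xs → Unique (map f xs)
map⁺-injectiveOn f inj []         []           = []
map⁺-injectiveOn f inj (px ∷ pxs) (x∉xs ∷ xs!) =
  All.map⁺ (All.zipWith (λ (x≢y , py) → x≢y ∘ inj px py) (x∉xs , pxs)) ∷ map⁺-injectiveOn f inj pxs xs!

-- Close and far pairs in a set of naturals

/-≡⇒∸< : ∀ m n d .{{_ : NonZero d}} → m / d ≡ n / d → n ∸ m < d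
/-≡⇒∸< m n d same = begin-strict
  n ∸ m              ≤⟨ ∸-monoʳ-≤ n (m/n*n≤m m d) ⟩
  n ∸ (m / d) * d    ≡⟨ cong (λ q → n ∸ q * d) same ⟩
  n ∸ (n / d) * d    ≡⟨ m%n≡m∸m/n*n n d ⟨
  n % d              <⟨ m%n<n n d ⟩
  d                  ∎
  where open ≤-Reasoning

%-/-injective : ∀ m n d .{{_ : NonZero d}} → m % d ≡ n % d → m / d ≡ n / d → m ≡ n
%-/-injective m n d same-% same-/ = begin
  m                    ≡⟨ m≡m%n+[m/n]*n m d ⟩
  m % d + (m / d) * d  ≡⟨ cong₂ (λ r q → r + q * d) same-% same-/ ⟩
  n % d + (n / d) * d  ≡⟨ m≡m%n+[m/n]*n n d ⟨
  n                    ∎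
  where open ≡-Reasoning

close-pair : ∀ D .{{_ : NonZero D}} {N} {xs : List ℕ} → Unique xs → All (_≤ N) xs →
             suc (N / D) < length xs → ∃₂ λ x g → x ∈ xs × x + suc g ∈ xs × suc g < D
close-pair D {N} {xs} xs! ≤N N/D<n =
  ordered (pigeonhole-∈ (_/ D) xs! (All.map (λ x≤N → s≤s (/-monoˡ-≤ D x≤N)) ≤N) N/D<n)
  where
  pair : ∀ {x y} → x < y → x / D ≡ y / D → x ∈ xs → y ∈ xs →
         ∃₂ λ x g → x ∈ xs × x + suc g ∈ xs × suc g < D
  pair {x} {y} x<y same x∈ y∈ =
    x , y ∸ suc x , x∈ , subst (_∈ xs) (sym (trans (+-suc x _) (m+[n∸m]≡n x<y))) y∈ ,
    subst (_< D) (+-∸-assoc 1 x<y) (/-≡⇒∸< x y D same)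
  ordered : (∃₂ λ x y → x ∈ xs × y ∈ xs × x ≢ y × x / D ≡ y / D) →
            ∃₂ λ x g → x ∈ xs × x + suc g ∈ xs × suc g < D
  ordered (x , y , x∈ , y∈ , x≢y , same) with <-cmp x y
  ... | tri< x<y _   _   = pair x<y same x∈ y∈
  ... | tri≈ _   x≡y _   = ⊥-elim (x≢y x≡y)
  ... | tri> _   _   y<x = pair y<x (sym same) y∈ x∈

residue-class-spread : ∀ g .{{_ : NonZero g}} {r} {ys : List ℕ} → Unique ys → All (λ y → y % g ≡ r) ys →
                       1 ≤ length ys → ∃₂ λ y ℓ → y ∈ ys × y + ℓ * g ∈ ys × length ys ≤ suc ℓ
residue-class-spread g {r} {ys@(z ∷ zs)} ys! ≡r _ =
  lo , ℓ , lo∈ , subst (_∈ ys) hi≡lo+ℓg hi∈ , injective⇒length≤ level ys! level<1+ℓ level-injective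
  where
  lo = min z zs
  hi = max z zs
  lo∈ : lo ∈ ys
  lo∈ = [ here , there ]′ (argmin-sel id z zs)
  hi∈ : hi ∈ ys
  hi∈ = [ here , there ]′ (argmax-sel id z zs)
  lo≤ : All (lo ≤_) ys
  lo≤ = min≤⊤ z zs ∷ min≤xs z zs
  ≤hi : All (_≤ hi) ys
  ≤hi = ⊥≤max z zs ∷ xs≤max z zs
  level : ℕ → ℕ
  level y = y / g ∸ lo / g
  ℓ = level hi
  lo/g≤ : ∀ {y} → y ∈ ys → lo / g ≤ y / g
  lo/g≤ y∈ = /-monoˡ-≤ g (All.lookup lo≤ y∈)
  hi≡lo+ℓg : hi ≡ lo + ℓ * g
  hi≡lo+ℓg = begin
    hi                           ≡⟨ m≡m%n+[m/n]*n hi g ⟩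
    hi % g + (hi / g) * g        ≡⟨ cong₂ (λ r q → r + q * g) (trans (All.lookup ≡r hi∈) (sym (All.lookup ≡r lo∈)))
                                                               (sym (m+[n∸m]≡n (lo/g≤ hi∈))) ⟩
    lo % g + (lo / g + ℓ) * g    ≡⟨ cong (_+_ (lo % g)) (*-distribʳ-+ g (lo / g) ℓ) ⟩
    lo % g + ((lo / g) * g + ℓ * g) ≡⟨ +-assoc (lo % g) _ _ ⟨
    lo % g + (lo / g) * g + ℓ * g ≡⟨ cong (_+ ℓ * g) (m≡m%n+[m/n]*n lo g) ⟨
    lo + ℓ * g                   ∎
    where open ≡-Reasoning
  level<1+ℓ : All (λ y → level y < suc ℓ) ys
  level<1+ℓ = All.map (λ y≤hi → s≤s (∸-monoˡ-≤ (lo / g) (/-monoˡ-≤ g y≤hi))) ≤hi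
  level-injective : ∀ {x y} → x ∈ ys → y ∈ ys → level x ≡ level y → x ≡ y
  level-injective {x} {y} x∈ y∈ same =
    %-/-injective x y g (trans (All.lookup ≡r x∈) (sym (All.lookup ≡r y∈))) (∸-cancelʳ-≡ (lo/g≤ x∈) (lo/g≤ y∈) same)

far-pair : ∀ g .{{_ : NonZero g}} {xs : List ℕ} → Unique xs → 1 ≤ length xs →
           ∃₂ λ y ℓ → y ∈ xs × y + ℓ * g ∈ xs × length xs ≤ suc ℓ * g
far-pair g {xs} xs! 1≤n = from-class (pigeonhole-filter g (_% g) {xs} (All.tabulate (λ {x} _ → m%n<n x g)))
  where
  from-class : (∃[ r ] r < g × length xs ≤ g * length (filter (λ x → x % g ≟ r) xs)) →
               ∃₂ λ y ℓ → y ∈ xs × y + ℓ * g ∈ xs × length xs ≤ suc ℓ * g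
  from-class (r , _ , n≤g*c) =
    let class = filter (λ x → x % g ≟ r) xs
        1≤c : 1 ≤ length class
        1≤c = n≢0⇒n>0 (λ c≡0 → <⇒≢ (≤-trans 1≤n n≤g*c) (sym (trans (cong (g *_) c≡0) (*-zeroʳ g))))
        (y , ℓ , y∈ , y+ℓg∈ , c≤1+ℓ) =
          residue-class-spread g (Unique.filter⁺ (λ x → x % g ≟ r) xs!) (All.all-filter (λ x → x % g ≟ r) xs) 1≤c
    in y , ℓ , proj₁ (∈-filter⁻ (λ x → x % g ≟ r) y∈) , proj₁ (∈-filter⁻ (λ x → x % g ≟ r) y+ℓg∈) ,
       ≤-trans n≤g*c (≤-trans (*-monoʳ-≤ g c≤1+ℓ) (≤-reflexive (*-comm g (suc ℓ))))

-- Jumps and sumsets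

record Jump (d : ℕ) (A : List ℤ) : Set where
  field
    start  : ℤ
    steps  : ℕ
    start∈ : start ∈ A
    end∈   : start ℤ.+ + steps ℤ.* + d ∈ A
open Jump

stay : ∀ {d A u} → u ∈ A → Jump d A
stay {A = A} {u} u∈ = record
  { start = u ; steps = 0 ; start∈ = u∈ ; end∈ = subst (_∈ A) (sym (ℤ.+-identityʳ u)) u∈ }

sumFin-+-* : ∀ {K} (u : Fin K → ℤ) (e : Fin K → ℕ) d →
             sumFin K (λ i → u i ℤ.+ + e i ℤ.* + d) ≡ sumFin K u ℤ.+ + sum e ℤ.* + d
sumFin-+-* {zero}  u e d = refl
sumFin-+-* {suc K} u e d = begin
  (u₀ ℤ.+ + e₀ ℤ.* + d) ℤ.+ sumFin K (λ i → u (suc i) ℤ.+ + e (suc i) ℤ.* + d)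
    ≡⟨ cong (ℤ._+_ (u₀ ℤ.+ + e₀ ℤ.* + d)) (sumFin-+-* (u ∘ suc) (e ∘ suc) d) ⟩
  (u₀ ℤ.+ + e₀ ℤ.* + d) ℤ.+ (sumFin K (u ∘ suc) ℤ.+ + sum (e ∘ suc) ℤ.* + d)
    ≡⟨ regroup u₀ (sumFin K (u ∘ suc)) (+ e₀) (+ sum (e ∘ suc)) (+ d) ⟩
  sumFin (suc K) u ℤ.+ (+ e₀ ℤ.+ + sum (e ∘ suc)) ℤ.* + d
    ≡⟨ cong (λ s → sumFin (suc K) u ℤ.+ s ℤ.* + d) (ℤ.pos-+ e₀ (sum (e ∘ suc))) ⟨
  sumFin (suc K) u ℤ.+ + sum e ℤ.* + d
    ∎
  where
  open ≡-Reasoning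
  u₀ = u zero
  e₀ = e zero
  regroup : ∀ a b x y z → (a ℤ.+ x ℤ.* z) ℤ.+ (b ℤ.+ y ℤ.* z) ≡ (a ℤ.+ b) ℤ.+ (x ℤ.+ y) ℤ.* z
  regroup = ℤ-Solver.solve-∀

progression⊆sumset : ∀ {K d} {A : Fin K → List ℤ} (J : (i : Fin K) → Jump d (A i)) →
                     (∀ i → steps (J i) ≤ suc (ones (steps ∘ J))) → ∀ {n} → n ≤ sum (steps ∘ J) →
                     (sumFin K (start ∘ J) ℤ.+ + n ℤ.* + d) ∈Sumset A
progression⊆sumset {K} {d} {A} J bounded n≤ with s , Σ≡n ← subsetSums-cover (steps ∘ J) bounded n≤
  = chosen , chosen∈ ,
    trans (sumFin-+-* (start ∘ J) (select s (steps ∘ J)) d) (cong (λ m → sumFin K (start ∘ J) ℤ.+ + m ℤ.* + d) Σ≡n)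
  where
  chosen : Fin K → ℤ
  chosen i = start (J i) ℤ.+ + select s (steps ∘ J) i ℤ.* + d
  chosen∈ : ∀ i → chosen i ∈ A i
  chosen∈ i with s i
  ... | true  = end∈ (J i)
  ... | false = end∈ (stay {d} (start∈ (J i)))

shift : ℕ → ℤ → ℕ
shift M x = ∣ x ℤ.+ + M ∣

+shift : ∀ {M x} → InRange M x → + shift M x ≡ x ℤ.+ + M
+shift {M} {x} (-M≤x , _) =
  ℤ.0≤i⇒+∣i∣≡i (subst (ℤ._≤ x ℤ.+ + M) (ℤ.+-inverseˡ (+ M)) (ℤ.+-monoˡ-≤ (+ M) -M≤x))

shift≤ : ∀ {M x} → InRange M x → shift M x ≤ M + M
shift≤ {M} x∈[-M,M]@(_ , x≤M) =
  ℤ.drop‿+≤+ (subst₂ ℤ._≤_ (sym (+shift x∈[-M,M])) (sym (ℤ.pos-+ M M)) (ℤ.+-monoˡ-≤ (+ M) x≤M))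

shift-injective : ∀ {M x y} → InRange M x → InRange M y → shift M x ≡ shift M y → x ≡ y
shift-injective {M} x∈ y∈ same =
  ∙-cancelʳ (+ M) _ _ (trans (sym (+shift x∈)) (trans (cong +_ same) (+shift y∈)))

shift-jump : ∀ {M A} → All (InRange M) A → ∀ {n} ℓ d →
             n ∈ map (shift M) A → n + ℓ * d ∈ map (shift M) A → Jump d A
shift-jump {M} {A} A⊆ {n} ℓ d n∈ n+ℓd∈ =
  record { start = x ; steps = ℓ ; start∈ = x∈ ; end∈ = subst (_∈ A) y≡x+ℓd y∈ }
  where
  open ≡-Reasoning
  x = proj₁ (∈-map⁻ (shift M) n∈)
  x∈ = proj₁ (proj₂ (∈-map⁻ (shift M) n∈))
  n≡ = proj₂ (proj₂ (∈-map⁻ (shift M) n∈))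
  y = proj₁ (∈-map⁻ (shift M) n+ℓd∈)
  y∈ = proj₁ (proj₂ (∈-map⁻ (shift M) n+ℓd∈))
  n+ℓd≡ = proj₂ (proj₂ (∈-map⁻ (shift M) n+ℓd∈))
  swap : ∀ a b c → (a ℤ.+ b) ℤ.+ c ≡ (a ℤ.+ c) ℤ.+ b
  swap = ℤ-Solver.solve-∀
  y≡x+ℓd : y ≡ x ℤ.+ + ℓ ℤ.* + d
  y≡x+ℓd = ∙-cancelʳ (+ M) _ _ (begin
    y ℤ.+ + M                    ≡⟨ +shift (All.lookup A⊆ y∈) ⟨
    + shift M y                  ≡⟨ cong +_ n+ℓd≡ ⟨
    + (n + ℓ * d)                ≡⟨ ℤ.pos-+ n (ℓ * d) ⟩
    + n ℤ.+ + (ℓ * d)            ≡⟨ cong₂ ℤ._+_ (trans (cong +_ n≡) (+shift (All.lookup A⊆ x∈))) (ℤ.pos-* ℓ d) ⟩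
    (x ℤ.+ + M) ℤ.+ + ℓ ℤ.* + d  ≡⟨ swap x (+ M) (+ ℓ ℤ.* + d) ⟩
    (x ℤ.+ + ℓ ℤ.* + d) ℤ.+ + M  ∎)

-- In ℚᵘ the product q * n is not normalised, so these inequalities unfold to cross-multiplications in ℕ.
ℕ→ℚ-≃ : ∀ n → toℚᵘ (ℕ→ℚ n) ≃ᵘ mkℚᵘ (+ n) 0
ℕ→ℚ-≃ n = toℚᵘ-fromℚᵘ (mkℚᵘ (+ n) 0)

toℚᵘ-*ℕ→ℚ : ∀ q n → toℚᵘ (q *ℚ ℕ→ℚ n) ≃ᵘ toℚᵘ q *ᵘ mkℚᵘ (+ n) 0
toℚᵘ-*ℕ→ℚ q n = ℚᵘ.≃-trans (toℚᵘ-homo-* q (ℕ→ℚ n)) (ℚᵘ.*-congˡ {toℚᵘ q} (ℕ→ℚ-≃ n))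

*ℕ→ℚ≤ℕ→ℚ⇒ : ∀ q m n → Positive q → q *ℚ ℕ→ℚ m ≤ℚ ℕ→ℚ n → ∣ ↥ q ∣ * m ≤ n * ↧ₙ q
*ℕ→ℚ≤ℕ→ℚ⇒ q@(mkℚ +[1+ a ] d _) m n _ q*m≤n
  with *≤* le ← ℚᵘ.≤-respʳ-≃ (ℕ→ℚ-≃ n) (ℚᵘ.≤-respˡ-≃ (toℚᵘ-*ℕ→ℚ q m) (toℚᵘ-mono-≤ q*m≤n))
  = ℤ.drop‿+≤+ (subst₂ ℤ._≤_ (trans (ℤ.*-identityʳ _) (ℤ.+◃n≡+n (suc a * m)))
                             (trans (sym (ℤ.pos-* n _)) (cong (λ k → + (n * suc k)) (*-identityʳ d))) le)

ℕ→ℚ≤*ℕ→ℚ⇒ : ∀ q m n → Positive q → ℕ→ℚ n ≤ℚ q *ℚ ℕ→ℚ m → n * ↧ₙ q ≤ ∣ ↥ q ∣ * m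
ℕ→ℚ≤*ℕ→ℚ⇒ q@(mkℚ +[1+ a ] d _) m n _ n≤q*m
  with *≤* le ← ℚᵘ.≤-respˡ-≃ (ℕ→ℚ-≃ n) (ℚᵘ.≤-respʳ-≃ (toℚᵘ-*ℕ→ℚ q m) (toℚᵘ-mono-≤ n≤q*m))
  = ℤ.drop‿+≤+ (subst₂ ℤ._≤_ (trans (sym (ℤ.pos-* n _)) (cong (λ k → + (n * suc k)) (*-identityʳ d)))
                             (trans (ℤ.*-identityʳ _) (ℤ.+◃n≡+n (suc a * m))) le)

ℕ→ℚ-cancel-≤ : ∀ {m n} → ℕ→ℚ m ≤ℚ ℕ→ℚ n → m ≤ n
ℕ→ℚ-cancel-≤ {m} {n} m≤n
  with *≤* le ← ℚᵘ.≤-respʳ-≃ (ℕ→ℚ-≃ n) (ℚᵘ.≤-respˡ-≃ (ℕ→ℚ-≃ m) (toℚᵘ-mono-≤ m≤n))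
  = ℤ.drop‿+≤+ (subst₂ ℤ._≤_ (ℤ.*-identityʳ (+ m)) (ℤ.*-identityʳ (+ n)) le)

positive⇒∣↥∣≢0 : ∀ q → Positive q → NonZero ∣ ↥ q ∣
positive⇒∣↥∣≢0 (mkℚ +[1+ _ ] _ _) _ = _

blocks<length : ∀ P .{{_ : NonZero P}} {M n} → 2 ≤ n → M ≤ n * P → suc ((M + M) / suc (4 * P)) < n
blocks<length P {M} {n} 2≤n M≤nP with (M + M) / suc (4 * P) | m/n*n≤m (M + M) (suc (4 * P))
... | zero  | _ = 2≤n
... | suc q | cD≤2M = *-cancelˡ-< (2 * P) (suc (suc q)) n (begin-strict
  2 * P * suc (suc q)        ≡⟨ *-suc (2 * P) (suc q) ⟩
  2 * P + 2 * P * suc q      ≤⟨ +-monoˡ-≤ (2 * P * suc q) (m≤m*n (2 * P) (suc q)) ⟩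
  2 * P * suc q + 2 * P * suc q ≡⟨ double (suc q) P ⟩
  suc q * (4 * P)            <⟨ m<n+m (suc q * (4 * P)) {suc q} z<s ⟩
  suc q + suc q * (4 * P)    ≡⟨ *-suc (suc q) (4 * P) ⟨
  suc q * suc (4 * P)        ≤⟨ cD≤2M ⟩
  M + M                      ≤⟨ +-mono-≤ M≤nP M≤nP ⟩
  n * P + n * P              ≡⟨ double′ n P ⟩
  2 * P * n                  ∎)
  where
  open ≤-Reasoning
  double : ∀ c P → 2 * P * c + 2 * P * c ≡ c * (4 * P)
  double = solve-∀
  double′ : ∀ n P → n * P + n * P ≡ 2 * P * n
  double′ = solve-∀

M≤[1+ℓ]E⇒M≤2Eℓ : ∀ {M ℓ E} → M ≤ suc ℓ * E → 2 * E ≤ M → M ≤ 2 * E * ℓ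
M≤[1+ℓ]E⇒M≤2Eℓ {M} {ℓ} {E} M≤ 2E≤M = +-cancelʳ-≤ M M (2 * E * ℓ) (begin
  M + M                      ≤⟨ +-mono-≤ M≤ M≤ ⟩
  suc ℓ * E + suc ℓ * E      ≡⟨ regroup ℓ E ⟩
  2 * E * ℓ + 2 * E          ≤⟨ +-monoʳ-≤ (2 * E * ℓ) 2E≤M ⟩
  2 * E * ℓ + M              ∎)
  where
  open ≤-Reasoning
  regroup : ∀ ℓ E → suc ℓ * E + suc ℓ * E ≡ 2 * E * ℓ + 2 * E
  regroup = solve-∀

-- Where the constants come from: a long jump of ℓ steps of size d ≤ 4P inside a set of at least M/P
-- elements satisfies M ≤ (ℓ + 1) E, hence M ≤ M₀ ℓ as soon as M₀ ≤ M.  The first 4P·X·M indices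
-- provide X·M unit jumps (at least 2M, and at least bM² when M ≤ M₀); the remaining M₀·b·M indices
-- provide the long jumps that reach bM² when M₀ ≤ M.
E : ℕ → ℕ
E P = 4 * P * P

M₀ : ℕ → ℕ
M₀ P = 2 * E P

X : ℕ → ℕ → ℕ
X P b = 2 + b * (M₀ P * M₀ P)

C : ℕ → ℕ → ℕ
C P b = 4 * P * X P b + M₀ P * b

module Construction (P : ℕ) .{{_ : NonZero P}} (b : ℕ) {M K : ℕ} (1≤M : 1 ≤ M) (CM≤K : C P b * M ≤ K)
  (A : Fin K → List ℤ) (A! : ∀ i → Unique (A i)) (A⊆ : ∀ i → All (InRange M) (A i))
  (2≤∣A∣ : ∀ i → 2 ≤ length (A i)) (M≤∣A∣P : ∀ i → M ≤ length (A i) * P) where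

  instance
    4P≢0 : NonZero (4 * P)
    4P≢0 = m*n≢0 4 P
    E≢0 : NonZero (E P)
    E≢0 = m*n≢0 (4 * P) P
    M₀≢0 : NonZero (M₀ P)
    M₀≢0 = m*n≢0 2 (E P)
    M≢0 : NonZero M
    M≢0 = >-nonZero 1≤M

  xs : Fin K → List ℕ
  xs i = map (shift M) (A i)

  xs! : ∀ i → Unique (xs i)
  xs! i = map⁺-injectiveOn (shift M) shift-injective (A⊆ i) (A! i)

  xs≤2M : ∀ i → All (_≤ M + M) (xs i)
  xs≤2M i = All.map⁺ (All.map shift≤ (A⊆ i))

  2≤∣xs∣ : ∀ i → 2 ≤ length (xs i)
  2≤∣xs∣ i = subst (2 ≤_) (sym (length-map (shift M) (A i))) (2≤∣A∣ i)

  M≤∣xs∣P : ∀ i → M ≤ length (xs i) * P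
  M≤∣xs∣P i = subst (λ n → M ≤ n * P) (sym (length-map (shift M) (A i))) (M≤∣A∣P i)

  -- Opaque, so that the with-abstractions in jump below do not unfold these witnesses.
  opaque
    close-pair-in : ∀ i → ∃[ x ] ∃[ g ] x ∈ xs i × x + suc g ∈ xs i × suc g < suc (4 * P)
    close-pair-in i = close-pair (suc (4 * P)) (xs! i) (xs≤2M i) (blocks<length P (2≤∣xs∣ i) (M≤∣xs∣P i))

  gap : Fin K → ℕ
  gap i = proj₁ (proj₂ (close-pair-in i))

  gap<4P : ∀ i → gap i < 4 * P
  gap<4P i = s≤s⁻¹ (proj₂ (proj₂ (proj₂ (proj₂ (close-pair-in i)))))

  h : ℕ
  h = 4 * P * X P b * M

  h≤K : h ≤ K
  h≤K = ≤-trans (*-monoˡ-≤ M (m≤m+n (4 * P * X P b) (M₀ P * b))) CM≤K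

  front : Fin K → Bool
  front i = toℕ i <ᵇ h

  opaque
    common-gap : ∃[ g ] g < 4 * P × count front ≤ 4 * P * count (λ i → front i ∧ (gap i ≡ᵇ g))
    common-gap = pigeonhole-count (4 * P) front gap gap<4P

  g : ℕ
  g = proj₁ common-gap

  d : ℕ
  d = suc g

  unit : Fin K → Bool
  unit i = front i ∧ (gap i ≡ᵇ g)

  XM≤count-unit : X P b * M ≤ count unit
  XM≤count-unit = *-cancelˡ-≤ (4 * P) (begin
    4 * P * (X P b * M)  ≡⟨ *-assoc (4 * P) (X P b) M ⟨
    h                    ≡⟨ count-<ᵇ h≤K ⟨
    count front          ≤⟨ proj₂ (proj₂ common-gap) ⟩
    4 * P * count unit   ∎)
    where open ≤-Reasoning

  opaque
    far-pair-in : ∀ i → ∃[ y ] ∃[ ℓ ] y ∈ xs i × y + ℓ * d ∈ xs i × length (xs i) ≤ suc ℓ * d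
    far-pair-in i = far-pair d (xs! i) (≤-trans (s≤s z≤n) (2≤∣xs∣ i))

  long-jump : ∀ i → Jump d (A i)
  long-jump i = let (y , ℓ , y∈ , y+ℓd∈ , _) = far-pair-in i in shift-jump (A⊆ i) ℓ d y∈ y+ℓd∈

  long-steps≤2M : ∀ i → steps (long-jump i) ≤ M + M
  long-steps≤2M i =
    let (y , ℓ , _ , y+ℓd∈ , _) = far-pair-in i
    in ≤-trans (m≤m*n ℓ d) (≤-trans (m≤n+m (ℓ * d) y) (All.lookup (xs≤2M i) y+ℓd∈))

  M≤[1+long-steps]E : ∀ i → M ≤ suc (steps (long-jump i)) * E P
  M≤[1+long-steps]E i =
    let (_ , ℓ , _ , _ , ∣xs∣≤) = far-pair-in i
    in begin
      M                    ≤⟨ M≤∣xs∣P i ⟩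
      length (xs i) * P    ≤⟨ *-monoˡ-≤ P (≤-trans ∣xs∣≤ (*-monoʳ-≤ (suc ℓ) (proj₁ (proj₂ common-gap)))) ⟩
      suc ℓ * (4 * P) * P  ≡⟨ *-assoc (suc ℓ) (4 * P) P ⟩
      suc ℓ * E P          ∎
    where open ≤-Reasoning

  unit-jump : ∀ i → gap i ≡ g → Jump d (A i)
  unit-jump i gap≡g =
    let (x , _ , x∈ , x+gap∈ , _) = close-pair-in i
    in shift-jump (A⊆ i) 1 d x∈ (subst (λ e → x + e ∈ xs i) (trans (cong suc gap≡g) (sym (*-identityˡ d))) x+gap∈)

  jump : ∀ i → Jump d (A i)
  jump i with front i | gap i ≟ g
  ... | true  | yes gap≡g = unit-jump i gap≡g
  ... | true  | no  _     = stay (start∈ (long-jump i))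
  ... | false | _         = long-jump i

  steps≤2M : ∀ i → steps (jump i) ≤ M + M
  steps≤2M i with front i | gap i ≟ g
  ... | true  | yes _ = ≤-trans 1≤M (m≤m+n M M)
  ... | true  | no  _ = z≤n
  ... | false | _     = long-steps≤2M i

  unit⇒steps≡1 : ∀ i → T (unit i) → steps (jump i) ≡ 1
  unit⇒steps≡1 i with front i | gap i ≟ g
  ... | true  | yes _     = λ _ → refl
  ... | true  | no  gap≢g = λ gap≡ᵇg → ⊥-elim (gap≢g (≡ᵇ⇒≡ (gap i) g gap≡ᵇg))
  ... | false | _         = λ ()

  back⇒M≤M₀*steps : M₀ P ≤ M → ∀ i → T (not (front i)) → M ≤ M₀ P * steps (jump i)
  back⇒M≤M₀*steps M₀≤M i with front i | gap i ≟ g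
  ... | true  | _ = λ ()
  ... | false | _ = λ _ → M≤[1+ℓ]E⇒M≤2Eℓ {E = E P} (M≤[1+long-steps]E i) M₀≤M

  XM≤ones : X P b * M ≤ ones (steps ∘ jump)
  XM≤ones = ≤-trans XM≤count-unit
              (count-mono (λ i unitᵢ → subst (λ s → T (s ≡ᵇ 1)) (sym (unit⇒steps≡1 i unitᵢ)) tt))

  steps≤1+ones : ∀ i → steps (jump i) ≤ suc (ones (steps ∘ jump))
  steps≤1+ones i = m≤n⇒m≤1+n (≤-trans (steps≤2M i) (≤-trans (+-monoʳ-≤ M (m≤m+n M _)) XM≤ones))

  M₀bM≤count-back : M₀ P * b * M ≤ count (not ∘ front)
  M₀bM≤count-back = begin
    M₀ P * b * M                       ≤⟨ m+n≤o⇒m≤o∸n (M₀ P * b * M) (≤-trans (≤-reflexive split) CM≤K) ⟩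
    K ∸ h                              ≡⟨ cong (_∸ h) (count+count-not front) ⟨
    count front + count (not ∘ front) ∸ h ≡⟨ cong (λ n → n + count (not ∘ front) ∸ h) (count-<ᵇ h≤K) ⟩
    h + count (not ∘ front) ∸ h        ≡⟨ m+n∸m≡n h _ ⟩
    count (not ∘ front)                ∎
    where
    open ≤-Reasoning
    split : M₀ P * b * M + h ≡ C P b * M
    split = trans (+-comm (M₀ P * b * M) h) (sym (*-distribʳ-+ M (4 * P * X P b) (M₀ P * b)))

  bM²≤steps : b * (M * M) ≤ sum (steps ∘ jump)
  bM²≤steps with M ≤? M₀ P
  ... | yes M≤M₀ = begin
    b * (M * M)          ≤⟨ *-monoʳ-≤ b (*-mono-≤ M≤M₀ M≤M₀) ⟩
    b * (M₀ P * M₀ P)    ≤⟨ m≤n+m _ 2 ⟩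
    X P b                ≤⟨ m≤m*n (X P b) M ⟩
    X P b * M            ≤⟨ XM≤ones ⟩
    ones (steps ∘ jump)  ≤⟨ ones≤sum (steps ∘ jump) ⟩
    sum (steps ∘ jump)   ∎
    where open ≤-Reasoning
  ... | no  M≰M₀ = *-cancelˡ-≤ (M₀ P) (begin
    M₀ P * (b * (M * M))       ≡⟨ regroup (M₀ P) b M ⟩
    M * (M₀ P * b * M)         ≤⟨ *-monoʳ-≤ M M₀bM≤count-back ⟩
    M * count (not ∘ front)    ≤⟨ *-count≤*-sum M (M₀ P) (back⇒M≤M₀*steps (<⇒≤ (≰⇒> M≰M₀))) ⟩
    M₀ P * sum (steps ∘ jump)  ∎)
    where
    open ≤-Reasoning
    regroup : ∀ m b M → m * (b * (M * M)) ≡ M * (m * b * M)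
    regroup = solve-∀

  progression : ∃[ a ] ∃[ d ] 1 ≤ d × d ≤ 4 * P × (∀ {n} → n ≤ b * (M * M) → (a ℤ.+ + n ℤ.* + d) ∈Sumset A)
  progression = sumFin K (start ∘ jump) , d , s≤s z≤n , proj₁ (proj₂ common-gap) ,
                λ n≤ → progression⊆sumset jump steps≤1+ones (≤-trans n≤ bM²≤steps)

lemma2p12 : (δ B : ℚ) → Positive δ → Positive B →
  Σ ℕ λ C → Σ ℕ λ d₀ → (1 ≤ C) × (1 ≤ d₀) ×
    ((M K : ℕ) → 1 ≤ M → C * M ≤ K →
      (A : Fin K → List ℤ) →
      ((i : Fin K) → Unique (A i)) →
      ((i : Fin K) → All (InRange M) (A i)) →
      ((i : Fin K) → δ *ℚ ℕ→ℚ M ≤ℚ ℕ→ℚ (length (A i))) →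
      ℕ→ℚ 2 ≤ℚ δ *ℚ ℕ→ℚ M →
      Σ ℤ λ a → Σ ℕ λ d → (1 ≤ d) × (d ≤ d₀) ×
        ((i : ℕ) → ℕ→ℚ i ≤ℚ B *ℚ ℕ→ℚ (M * M) →
          (a ℤ.+ (+ i) ℤ.* (+ d)) ∈Sumset A))
lemma2p12 δ B δ>0 B>0 = C P b , 4 * P , s≤s z≤n , s≤s z≤n ,
  λ M K 1≤M CM≤K A A! A⊆ δM≤∣A∣ 2≤δM →
    let (a , d , 1≤d , d≤4P , a+nd∈) =
          Construction.progression P b 1≤M CM≤K A A! A⊆
            (λ i → ℕ→ℚ-cancel-≤ (≤ℚ-trans 2≤δM (δM≤∣A∣ i))) (λ i → dense M (length (A i)) (δM≤∣A∣ i))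
    in a , d , 1≤d , d≤4P , λ n n≤BM² → a+nd∈ (bounded (M * M) n n≤BM²)
  where
  P = ↧ₙ δ
  b = ∣ ↥ B ∣
  dense : ∀ m n → δ *ℚ ℕ→ℚ m ≤ℚ ℕ→ℚ n → m ≤ n * P
  dense m n δm≤n = ≤-trans (m≤n*m m ∣ ↥ δ ∣ {{positive⇒∣↥∣≢0 δ δ>0}}) (*ℕ→ℚ≤ℕ→ℚ⇒ δ m n δ>0 δm≤n)
  bounded : ∀ m n → ℕ→ℚ n ≤ℚ B *ℚ ℕ→ℚ m → n ≤ b * m
  bounded m n n≤Bm = ≤-trans (m≤m*n n (↧ₙ B)) (ℕ→ℚ≤*ℕ→ℚ⇒ B m n B>0 n≤Bm)
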